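{- Let $n\ge 13$ and let $S$ be an identifying code in $G=\mathrm{C}_n(1,3)$. If $u\in S$ is a heavy vertex, i.e. $\gamma(u)>11/4$, then $\pi(u)=(1,2,2,2,3)$.
   Context: $\mathrm{C}_n(1,3)$ has vertex set $\mathbb{Z}_n$, with $x,y$ adjacent iff $x-y\equiv\pm1$ or $\pm3\pmod n$. For $u\in\mathbb{Z}_n$, $N[u]$ is its closed neighbourhood and $S_u=N[u]\cap S$. $S$ is an identifying code if the sets $S_u$, $u\in\mathbb{Z}_n$, are all nonempty and pairwise distinct. The profile $\pi(u)$ is the 5-tuple of the numbers $|S_x|$, $x\in N[u]$, in ascending order. The share of $u\in S$ is $\gamma(u)=\sum_{x\in N[u]}1/|S_x|$. -}

module Defs where

open import Data.Bool using (Bool; true; false; _∨_; T)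
open import Data.Nat using (ℕ; zero; suc; _+_; _∸_; _≡ᵇ_; NonZero)
open import Data.Nat.DivMod using (_%_)
import Data.Nat.Properties as ℕₚ
open import Data.Fin using (Fin; toℕ)
open import Data.Fin.Subset using (Subset; _∩_; ∣_∣; Nonempty)
open import Data.Vec using (tabulate)
open import Data.Product using (_×_)
open import Data.List using (List; []; _∷_; map; filter; allFin; foldr)
open import Data.List.Sort ℕₚ.≤-decTotalOrder using (sort)
open import Data.Integer using (+_)
open import Data.Rational using (ℚ; 0ℚ; _/_) renaming (_+_ to _+ℚ_)
open import Relation.Nullary.Decidable using (T?)
open import Relation.Binary.PropositionalEquality using (_≡_; _≢_)

diff : ∀ {n} .{{_ : NonZero n}} → Fin n → Fin n → ℕ
diff {n} x y = (n + toℕ x ∸ toℕ y) % n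

inN : ∀ {n} .{{_ : NonZero n}} → Fin n → Fin n → Bool
inN {n} u x =
  let d = diff x u in
  (d ≡ᵇ 0) ∨ (d ≡ᵇ 1) ∨ (d ≡ᵇ 3) ∨ (d ≡ᵇ (n ∸ 1)) ∨ (d ≡ᵇ (n ∸ 3))

N[_] : ∀ {n} .{{_ : NonZero n}} → Fin n → Subset n
N[ u ] = tabulate (inN u)

Nlist : ∀ {n} .{{_ : NonZero n}} → Fin n → List (Fin n)
Nlist u = filter (λ x → T? (inN u x)) (allFin _)

S[_]_ : ∀ {n} .{{_ : NonZero n}} → Subset n → Fin n → Subset n
S[ S ] u = N[ u ] ∩ S

IdentifyingCode : ∀ {n} .{{_ : NonZero n}} → Subset n → Set
IdentifyingCode {n} S =
  (∀ (u : Fin n) → Nonempty (S[ S ] u)) × (∀ (u v : Fin n) → u ≢ v → S[ S ] u ≢ S[ S ] v)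

profile : ∀ {n} .{{_ : NonZero n}} → Subset n → Fin n → List ℕ
profile S u = sort (map (λ x → ∣ S[ S ] x ∣) (Nlist u))

-- 1/k as a rational (convention 1/0 = 0; irrelevant for identifying codes)
inv : ℕ → ℚ
inv zero = 0ℚ
inv (suc k) = + 1 / suc k

share : ∀ {n} .{{_ : NonZero n}} → Subset n → Fin n → ℚ
share S u = foldr (λ x acc → inv ∣ S[ S ] x ∣ +ℚ acc) 0ℚ (Nlist u)

module Submission where

-- Whether u is heavy, and what its profile is, depends only on which of the 13 vertices
-- u − 6, …, u + 6 lie in S: the sets S_x for x ∈ N[u] lie in this window, and of the
-- identifying property only the ten inequalities S_x ≠ S_y for x ≠ y in N[u] are needed.
-- For n ≥ 13 the window embeds into ℤ_n without wrapping around, so the theorem reduces to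
-- a statement about the 2^13 subsets of the window, which is decided by evaluation.

module Cyclic where

  open import Data.Nat
  open import Data.Nat.Properties
  open import Data.Nat.DivMod
  open import Data.Fin using (Fin; toℕ)
  open import Data.Fin.Properties using (toℕ<n; toℕ-fromℕ<; toℕ-injective)
  open import Data.Sum using (inj₁; inj₂)
  open import Relation.Nullary using (yes; no; contradiction)
  open import Relation.Binary.PropositionalEquality
  open ≡-Reasoning
  open import Defs using (diff)

  module _ {n : ℕ} .{{_ : NonZero n}} where

    [a%n+b]%n≡[a+b]%n : ∀ a b → (a % n + b) % n ≡ (a + b) % n
    [a%n+b]%n≡[a+b]%n a b = begin
      (a % n + b) % n           ≡⟨ %-distribˡ-+ (a % n) b n ⟩
      (a % n % n + b % n) % n   ≡⟨ cong (λ r → (r + b % n) % n) (m%n%n≡m%n a n) ⟩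
      (a % n + b % n) % n       ≡⟨ %-distribˡ-+ a b n ⟨
      (a + b) % n               ∎

    [a+d]%n≡a⇒d≡0 : ∀ {a d} → a < n → d < n → (a + d) % n ≡ a → d ≡ 0
    [a+d]%n≡a⇒d≡0 {a} {d} a<n d<n eq with a + d <? n
    ... | yes a+d<n = +-cancelˡ-≡ a d 0 (begin
      a + d        ≡⟨ m<n⇒m%n≡m a+d<n ⟨
      (a + d) % n  ≡⟨ eq ⟩
      a            ≡⟨ +-identityʳ a ⟨
      a + 0        ∎)
    ... | no a+d≮n = contradiction (+-cancelˡ-≡ a d n (begin
      a + d            ≡⟨ m∸n+n≡m n≤a+d ⟨
      a + d ∸ n + n    ≡⟨ cong (_+ n) a+d∸n≡a ⟩
      a + n            ∎)) (<⇒≢ d<n)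
      where
      n≤a+d : n ≤ a + d
      n≤a+d = ≮⇒≥ a+d≮n
      a+d∸n<n : a + d ∸ n < n
      a+d∸n<n = +-cancelʳ-< n (a + d ∸ n) n (subst (_< n + n) (sym (m∸n+n≡m n≤a+d)) (+-mono-< a<n d<n))
      a+d∸n≡a : a + d ∸ n ≡ a
      a+d∸n≡a = begin
        a + d ∸ n        ≡⟨ m<n⇒m%n≡m a+d∸n<n ⟨
        (a + d ∸ n) % n  ≡⟨ m≤n⇒[n∸m]%m≡n%m n≤a+d ⟩
        (a + d) % n      ≡⟨ eq ⟩
        a                ∎

    private
      +-cancelˡ-%-≤ : ∀ c {a b} → a ≤ b → b < n → (c + a) % n ≡ (c + b) % n → a ≡ b
      +-cancelˡ-%-≤ c {a} {b} a≤b b<n eq = begin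
        a              ≡⟨ +-identityʳ a ⟨
        a + 0          ≡⟨ cong (a +_) b∸a≡0 ⟨
        a + (b ∸ a)    ≡⟨ m+[n∸m]≡n a≤b ⟩
        b              ∎
        where
        b∸a≡0 : b ∸ a ≡ 0
        b∸a≡0 = [a+d]%n≡a⇒d≡0 (m%n<n (c + a) n) (≤-<-trans (m∸n≤m b a) b<n) (begin
          ((c + a) % n + (b ∸ a)) % n  ≡⟨ [a%n+b]%n≡[a+b]%n (c + a) (b ∸ a) ⟩
          (c + a + (b ∸ a)) % n        ≡⟨ cong (_% n) (+-assoc c a (b ∸ a)) ⟩
          (c + (a + (b ∸ a))) % n      ≡⟨ cong (λ x → (c + x) % n) (m+[n∸m]≡n a≤b) ⟩
          (c + b) % n                  ≡⟨ eq ⟨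
          (c + a) % n                  ∎)

    +-cancelˡ-% : ∀ c {a b} → a < n → b < n → (c + a) % n ≡ (c + b) % n → a ≡ b
    +-cancelˡ-% c a<n b<n eq with ≤-total _ _
    ... | inj₁ a≤b = +-cancelˡ-%-≤ c a≤b b<n eq
    ... | inj₂ b≤a = sym (+-cancelˡ-%-≤ c b≤a a<n (sym eq))

    shift : Fin n → ℕ → Fin n
    shift x t = (toℕ x + t) mod n

    toℕ-shift : ∀ x t → toℕ (shift x t) ≡ (toℕ x + t) % n
    toℕ-shift x t = toℕ-fromℕ< (m%n<n (toℕ x + t) n)

    shift-0 : ∀ x → shift x 0 ≡ x
    shift-0 x = toℕ-injective (begin
      toℕ (shift x 0)   ≡⟨ toℕ-shift x 0 ⟩
      (toℕ x + 0) % n   ≡⟨ cong (_% n) (+-identityʳ (toℕ x)) ⟩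
      toℕ x % n         ≡⟨ m<n⇒m%n≡m (toℕ<n x) ⟩
      toℕ x             ∎)

    shift-shift : ∀ x s t → shift (shift x s) t ≡ shift x (s + t)
    shift-shift x s t = toℕ-injective (begin
      toℕ (shift (shift x s) t)   ≡⟨ toℕ-shift (shift x s) t ⟩
      (toℕ (shift x s) + t) % n   ≡⟨ cong (λ r → (r + t) % n) (toℕ-shift x s) ⟩
      ((toℕ x + s) % n + t) % n   ≡⟨ [a%n+b]%n≡[a+b]%n (toℕ x + s) t ⟩
      (toℕ x + s + t) % n         ≡⟨ cong (_% n) (+-assoc (toℕ x) s t) ⟩
      (toℕ x + (s + t)) % n       ≡⟨ toℕ-shift x (s + t) ⟨
      toℕ (shift x (s + t))       ∎)

    shift-+n : ∀ x t → shift x (t + n) ≡ shift x t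
    shift-+n x t = toℕ-injective (begin
      toℕ (shift x (t + n))   ≡⟨ toℕ-shift x (t + n) ⟩
      (toℕ x + (t + n)) % n   ≡⟨ cong (_% n) (+-assoc (toℕ x) t n) ⟨
      (toℕ x + t + n) % n     ≡⟨ [m+n]%n≡m%n (toℕ x + t) n ⟩
      (toℕ x + t) % n         ≡⟨ toℕ-shift x t ⟨
      toℕ (shift x t)         ∎)

    shift-back : ∀ {k} → k ≤ n → ∀ x b → shift (shift x (k + b)) (n ∸ k) ≡ shift x b
    shift-back {k} k≤n x b = begin
      shift (shift x (k + b)) (n ∸ k)   ≡⟨ shift-shift x (k + b) (n ∸ k) ⟩
      shift x (k + b + (n ∸ k))         ≡⟨ cong (shift x) k+b+[n∸k]≡b+n ⟩
      shift x (b + n)                   ≡⟨ shift-+n x b ⟩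
      shift x b                         ∎
      where
      k+b+[n∸k]≡b+n : k + b + (n ∸ k) ≡ b + n
      k+b+[n∸k]≡b+n = begin
        k + b + (n ∸ k)     ≡⟨ cong (_+ (n ∸ k)) (+-comm k b) ⟩
        b + k + (n ∸ k)     ≡⟨ +-assoc b k (n ∸ k) ⟩
        b + (k + (n ∸ k))   ≡⟨ cong (b +_) (m+[n∸m]≡n k≤n) ⟩
        b + n               ∎

    shift-injective : ∀ x {s t} → s < n → t < n → shift x s ≡ shift x t → s ≡ t
    shift-injective x {s} {t} s<n t<n eq = +-cancelˡ-% (toℕ x) s<n t<n (begin
      (toℕ x + s) % n   ≡⟨ toℕ-shift x s ⟨
      toℕ (shift x s)   ≡⟨ cong toℕ eq ⟩
      toℕ (shift x t)   ≡⟨ toℕ-shift x t ⟩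
      (toℕ x + t) % n   ∎)

    shift-diff : ∀ j x → shift x (diff j x) ≡ j
    shift-diff j x = toℕ-injective (begin
      toℕ (shift x (diff j x))                ≡⟨ toℕ-shift x (diff j x) ⟩
      (toℕ x + (n + toℕ j ∸ toℕ x) % n) % n   ≡⟨ cong (_% n) (+-comm (toℕ x) _) ⟩
      ((n + toℕ j ∸ toℕ x) % n + toℕ x) % n   ≡⟨ [a%n+b]%n≡[a+b]%n (n + toℕ j ∸ toℕ x) (toℕ x) ⟩
      (n + toℕ j ∸ toℕ x + toℕ x) % n         ≡⟨ cong (_% n) (m∸n+n≡m x≤n+j) ⟩
      (n + toℕ j) % n                         ≡⟨ cong (_% n) (+-comm n (toℕ j)) ⟩
      (toℕ j + n) % n                         ≡⟨ [m+n]%n≡m%n (toℕ j) n ⟩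
      toℕ j % n                               ≡⟨ m<n⇒m%n≡m (toℕ<n j) ⟩
      toℕ j                                   ∎)
      where
      x≤n+j : toℕ x ≤ n + toℕ j
      x≤n+j = ≤-trans (<⇒≤ (toℕ<n x)) (m≤m+n n (toℕ j))

    diff-shift : ∀ x {t} → t < n → diff (shift x t) x ≡ t
    diff-shift x t<n = shift-injective x (m%n<n _ n) t<n (shift-diff (shift x _) x)

module Neighbourhood where

  open import Data.Bool using (T; _∨_)
  open import Data.Bool.Properties using (∨-identityʳ; T-≡)
  open import Data.Bool.ListAction using (any)
  open import Data.Nat
  open import Data.Nat.Properties using (≡ᵇ⇒≡; ≡⇒≡ᵇ; m<n+m; n<1+n)
  import Data.Fin.Subset as Subset
  open import Data.Product using (_,_; proj₂)
  open import Data.List using (List; []; _∷_; map; allFin)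
  open import Data.List.Membership.Propositional using (_∈_)
  open import Data.List.Membership.Propositional.Properties using (∈-filter⁺; ∈-filter⁻; ∈-allFin; ∈-map⁺; ∈-map⁻)
  open import Data.List.Relation.Unary.All as All using (All; []; _∷_)
  import Data.List.Relation.Unary.Any as Any
  open import Data.List.Relation.Unary.Any.Properties using (any⇔)
  open import Data.List.Relation.Unary.Unique.Propositional using (Unique)
  import Data.List.Relation.Unary.Unique.Propositional.Properties as Unique
  open import Data.Vec.Properties using (lookup∘tabulate; lookup⇒[]=; []=⇒lookup)
  open import Function using (_∘_; _⇔_; mk⇔; Equivalence)
  open import Function.Construct.Composition using (_⇔-∘_)
  import Function.Properties.Equivalence as ⇔
  open import Relation.Nullary.Decidable using (T?)
  open import Relation.Binary.PropositionalEquality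
  open import Defs
  open Cyclic

  module _ {n : ℕ} .{{_ : NonZero n}} where

    offsets : List ℕ
    offsets = 0 ∷ 1 ∷ 3 ∷ n ∸ 1 ∷ n ∸ 3 ∷ []

    offsets<n : 4 ≤ n → All (_< n) offsets
    offsets<n (s≤s (s≤s (s≤s (s≤s {n = k} z≤n)))) =
      s≤s z≤n ∷ s≤s (s≤s z≤n) ∷ s≤s (s≤s (s≤s (s≤s z≤n))) ∷ n<1+n (3 + k) ∷ m<n+m (1 + k) {3} (s≤s z≤n) ∷ []

    inN≡any : ∀ x j → inN x j ≡ any (diff j x ≡ᵇ_) offsets
    inN≡any x j = cong (λ b → (d ≡ᵇ 0) ∨ (d ≡ᵇ 1) ∨ (d ≡ᵇ 3) ∨ (d ≡ᵇ (n ∸ 1)) ∨ b) (sym (∨-identityʳ (d ≡ᵇ (n ∸ 3))))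
      where
      d : ℕ
      d = diff j x

    inN⇔diff∈offsets : ∀ x j → T (inN x j) ⇔ diff j x ∈ offsets
    inN⇔diff∈offsets x j = mk⇔
      (Any.map (≡ᵇ⇒≡ _ _) ∘ Equivalence.from any⇔ ∘ subst T (inN≡any x j))
      (subst T (sym (inN≡any x j)) ∘ Equivalence.to any⇔ ∘ Any.map (≡⇒≡ᵇ _ _))

    diff∈⇔∈-map-shift : ∀ {ts} → All (_< n) ts → ∀ x j → diff j x ∈ ts ⇔ j ∈ map (shift x) ts
    diff∈⇔∈-map-shift {ts} ts<n x j = mk⇔
      (λ d∈ts → subst (_∈ map (shift x) ts) (shift-diff j x) (∈-map⁺ (shift x) d∈ts))
      from
      where
      from : j ∈ map (shift x) ts → diff j x ∈ ts
      from j∈ with ∈-map⁻ (shift x) j∈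
      ... | t , t∈ts , refl = subst (_∈ ts) (sym (diff-shift x (All.lookup ts<n t∈ts))) t∈ts

    ∈-Nlist⇔ : ∀ x j → j ∈ Nlist x ⇔ T (inN x j)
    ∈-Nlist⇔ x j = mk⇔ (proj₂ ∘ ∈-filter⁻ (T? ∘ inN x) {xs = allFin n}) (∈-filter⁺ (T? ∘ inN x) (∈-allFin j))

    ∈-N⇔ : ∀ x j → j Subset.∈ N[ x ] ⇔ T (inN x j)
    ∈-N⇔ x j = mk⇔
      (λ j∈N → Equivalence.from T-≡ (trans (sym (lookup∘tabulate (inN x) j)) ([]=⇒lookup j∈N)))
      (λ t → lookup⇒[]= j N[ x ] (trans (lookup∘tabulate (inN x) j) (Equivalence.to T-≡ t)))

    ∈-N⇔∈-Nlist : ∀ x j → j Subset.∈ N[ x ] ⇔ j ∈ Nlist x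
    ∈-N⇔∈-Nlist x j = ⇔.sym (∈-Nlist⇔ x j) ⇔-∘ ∈-N⇔ x j

    ∈-Nlist⇔∈-map-shift : 4 ≤ n → ∀ x j → j ∈ Nlist x ⇔ j ∈ map (shift x) offsets
    ∈-Nlist⇔∈-map-shift 4≤n x j =
      diff∈⇔∈-map-shift (offsets<n 4≤n) x j ⇔-∘ (inN⇔diff∈offsets x j ⇔-∘ ∈-Nlist⇔ x j)

    Nlist-unique : ∀ x → Unique (Nlist x)
    Nlist-unique x = Unique.filter⁺ (T? ∘ inN x) (Unique.allFin⁺ n)

module ListFacts where

  open import Data.Bool using (Bool; true; false)
  open import Data.Bool.Properties using (T-≡)
  open import Data.Nat using (ℕ; suc)
  import Data.Nat.Properties as ℕ
  open import Data.Fin using (Fin)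
  import Data.Fin as Fin
  open import Data.Fin.Subset using (Subset; ∣_∣; _∈_)
  open import Data.Product using (_,_; proj₂)
  open import Data.Vec using (lookup) renaming ([] to []ᵥ; _∷_ to _∷ᵥ_)
  open import Data.Vec.Properties using (lookup⇒[]=; []=⇒lookup)
  open import Data.List using (List; map; filterᵇ; length; tabulate; allFin)
  import Data.List.Membership.Propositional as List
  open import Data.List.Membership.Propositional.Properties using (∈-filter⁺; ∈-filter⁻; ∈-allFin)
  open import Data.List.Membership.Propositional.Properties.WithK using (unique∧set⇒bag)
  open import Data.List.Relation.Unary.All as All using (All; []; _∷_)
  open import Data.List.Relation.Unary.AllPairs using (AllPairs; []; _∷_)
  import Data.List.Relation.Unary.AllPairs.Properties as AllPairs
  open import Data.List.Relation.Unary.Unique.Propositional using (Unique)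
  import Data.List.Relation.Unary.Unique.Propositional.Properties as Unique
  open import Data.List.Relation.Unary.Sorted.TotalOrder ℕ.≤-totalOrder using (Sorted)
  open import Data.List.Relation.Unary.Sorted.TotalOrder.Properties using (↗↭↗⇒≋)
  open import Data.List.Relation.Binary.BagAndSetEquality using (∼bag⇒↭)
  open import Data.List.Relation.Binary.Permutation.Propositional using (_↭_; ↭-trans; ↭⇒↭ₛ)
  open import Data.List.Relation.Binary.Permutation.Propositional.Properties using (↭-length)
  open import Data.List.Relation.Binary.Pointwise using (Pointwise-≡⇒≡)
  open import Data.List.Sort ℕ.≤-decTotalOrder using (sort; sort-↗; sort-↭)
  open import Function using (_∘_; _⇔_; mk⇔; Equivalence)
  open import Relation.Nullary.Decidable using (T?)
  open import Relation.Binary.PropositionalEquality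

  AllPairs-map-on : ∀ {A : Set} {P : A → Set} {R R' : A → A → Set} →
                    (∀ {x y} → P x → P y → R x y → R' x y) →
                    ∀ {xs} → All P xs → AllPairs R xs → AllPairs R' xs
  AllPairs-map-on f []         []         = []
  AllPairs-map-on f (px ∷ pxs) (Rx ∷ Rxs) =
    All.zipWith (λ (py , Rxy) → f px py Rxy) (pxs , Rx) ∷ AllPairs-map-on f pxs Rxs

  map⁺-Unique-on : ∀ {A B : Set} {P : A → Set} {f : A → B} →
                   (∀ {x y} → P x → P y → f x ≡ f y → x ≡ y) →
                   ∀ {xs} → All P xs → Unique xs → Unique (map f xs)
  map⁺-Unique-on inj pxs xs! = AllPairs.map⁺ (AllPairs-map-on (λ px py x≢y → x≢y ∘ inj px py) pxs xs!)

  length-filter-tabulate : ∀ {k} {A : Set} (p : Subset k) (f : Fin k → A) (P : A → Bool) →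
                           (∀ i → P (f i) ≡ lookup p i) → length (filterᵇ P (tabulate f)) ≡ ∣ p ∣
  length-filter-tabulate []ᵥ      f P agree = refl
  length-filter-tabulate (b ∷ᵥ p) f P agree with P (f Fin.zero) | agree Fin.zero
  ... | true  | refl = cong suc (length-filter-tabulate p (f ∘ Fin.suc) P (agree ∘ Fin.suc))
  ... | false | refl = length-filter-tabulate p (f ∘ Fin.suc) P (agree ∘ Fin.suc)

  length≡∣∣ : ∀ {n} {q : Subset n} {xs : List (Fin n)} → Unique xs → (∀ {j} → j List.∈ xs ⇔ j ∈ q) →
              length xs ≡ ∣ q ∣
  length≡∣∣ {n} {q} {xs} xs! xs⇔q = begin
    length xs       ≡⟨ ↭-length (∼bag⇒↭ (unique∧set⇒bag xs! members! (mk⇔ (from members⇔q ∘ to xs⇔q) (from xs⇔q ∘ to members⇔q)))) ⟩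
    length members  ≡⟨ length-filter-tabulate q (λ i → i) (lookup q) (λ i → refl) ⟩
    ∣ q ∣           ∎
    where
    open ≡-Reasoning
    open Equivalence
    members : List (Fin n)
    members = filterᵇ (lookup q) (allFin n)
    members! : Unique members
    members! = Unique.filter⁺ (T? ∘ lookup q) (Unique.allFin⁺ n)
    members⇔q : ∀ {j} → j List.∈ members ⇔ j ∈ q
    members⇔q {j} = mk⇔
      (λ j∈ → lookup⇒[]= j q (to T-≡ (proj₂ (∈-filter⁻ (T? ∘ lookup q) {xs = allFin n} j∈))))
      (λ j∈q → ∈-filter⁺ (T? ∘ lookup q) (∈-allFin j) (from T-≡ ([]=⇒lookup j∈q)))

  sort-unique : ∀ {xs ys : List ℕ} → Sorted ys → xs ↭ ys → sort xs ≡ ys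
  sort-unique {xs} ys↗ xs↭ys = Pointwise-≡⇒≡ (↗↭↗⇒≋ ℕ.≤-totalOrder (sort-↗ xs) ys↗ (↭⇒↭ₛ (↭-trans (sort-↭ xs) xs↭ys)))

module LocalModel where

  open import Data.Bool using (Bool; false; T; T?)
  open import Data.Nat using (ℕ; zero; suc; _+_; _∸_; _≤_; _<_; s≤s; _≤?_)
  import Data.Nat.Properties as ℕ
  open import Data.Product using (_×_; _,_)
  open import Data.Fin using (toℕ)
  open import Data.Fin.Subset using (Subset)
  open import Data.Fin.Subset.Properties using (anySubset?)
  open import Data.Vec using (_∷_; []; tabulate)
  open import Data.List using (List; []; _∷_; map; filterᵇ; length; foldr)
  open import Data.List.Properties using (≡-dec; foldr-map)
  open import Data.List.Relation.Unary.All as All using (All)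
  open import Data.List.Relation.Unary.AllPairs as AllPairs using (AllPairs)
  open import Data.List.Relation.Unary.Unique.DecPropositional ℕ._≟_ using (Unique; unique?)
  open import Data.List.Relation.Binary.Subset.DecPropositional ℕ._≟_ using (_⊆_; _⊆?_)
  open import Data.List.Relation.Binary.Permutation.Propositional using (_↭_; ↭⇒↭ₛ)
  open import Data.List.Relation.Binary.Permutation.Propositional.Properties using (map⁺)
  import Data.List.Relation.Binary.Permutation.Setoid.Properties as Permutation
  open import Data.List.Sort.InsertionSort.Base ℕ.≤-decTotalOrder using (sort)
  open import Data.Integer using (+_)
  open import Data.Rational using (ℚ; 0ℚ; _/_) renaming (_+_ to _+ℚ_; _<_ to _<ℚ_)
  open import Data.Rational.Properties using (+-0-isCommutativeMonoid) renaming (_<?_ to _<ℚ?_)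
  open import Function using (_∘_)
  open import Relation.Nullary using (¬_; Dec)
  open import Relation.Nullary.Decidable using (¬?; _×-dec_; from-yes; from-no; decidable-stable)
  open import Relation.Binary.PropositionalEquality
  open import Defs using (inv)

  -- positions beyond the end of the pattern read as false
  at : ∀ {k} → Subset k → ℕ → Bool
  at []      _       = false
  at (b ∷ p) zero    = b
  at (b ∷ p) (suc c) = at p c

  at-tabulate : ∀ {k} (f : ℕ → Bool) {c} → c < k → at (tabulate {n = k} (f ∘ toℕ)) c ≡ f c
  at-tabulate {suc k} f {zero}  _         = refl
  at-tabulate {suc k} f {suc c} (s≤s c<k) = at-tabulate (f ∘ suc) c<k

  -- the positions of N[a], listed in the order of the offsets 0, 1, 3, −1, −3
  nbhd : ℕ → List ℕ
  nbhd a = a ∷ a + 1 ∷ a + 3 ∷ a ∸ 1 ∷ a ∸ 3 ∷ []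

  Inner : ℕ → Set
  Inner a = 3 ≤ a × All (_< 13) (nbhd a) × Unique (nbhd a)

  Inner⇒<13 : ∀ {a} → Inner a → a < 13
  Inner⇒<13 (_ , a<13 All.∷ _ , _) = a<13

  inner? : ∀ a → Dec (Inner a)
  inner? a = 3 ≤? a ×-dec All.all? (ℕ._<? 13) (nbhd a) ×-dec unique? (nbhd a)

  nbhd-6-inner : All Inner (nbhd 6)
  nbhd-6-inner = from-yes (All.all? inner? (nbhd 6))

  trace : (ℕ → Bool) → ℕ → List ℕ
  trace χ a = filterᵇ χ (nbhd a)

  weight : (ℕ → Bool) → ℕ → ℕ
  weight χ a = length (trace χ a)

  Separated : (ℕ → Bool) → ℕ → ℕ → Set
  Separated χ a a' = ¬ (trace χ a ⊆ trace χ a' × trace χ a' ⊆ trace χ a)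

  separated? : ∀ χ a a' → Dec (Separated χ a a')
  separated? χ a a' = ¬? ((trace χ a ⊆? trace χ a') ×-dec (trace χ a' ⊆? trace χ a))

  harmonic : List ℕ → ℚ
  harmonic = foldr (λ k q → inv k +ℚ q) 0ℚ

  harmonic-↭ : ∀ {ks ks'} → ks ↭ ks' → harmonic ks ≡ harmonic ks'
  harmonic-↭ {ks} {ks'} ks↭ks' = begin
    harmonic ks                 ≡⟨ foldr-map _ inv _ ks ⟨
    foldr _+ℚ_ 0ℚ (map inv ks)  ≡⟨ Permutation.foldr-commMonoid (setoid ℚ) +-0-isCommutativeMonoid (↭⇒↭ₛ (map⁺ inv ks↭ks')) ⟩
    foldr _+ℚ_ 0ℚ (map inv ks') ≡⟨ foldr-map _ inv _ ks' ⟩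
    harmonic ks'                ∎
    where open ≡-Reasoning

  counts : (ℕ → Bool) → List ℕ
  counts χ = map (weight χ) (nbhd 6)

  target : List ℕ
  target = 1 ∷ 2 ∷ 2 ∷ 2 ∷ 3 ∷ []

  -- Insertion sort, unlike the abstract sort of Data.List.Sort, evaluates; testing heaviness
  -- before separation keeps the evaluation over all patterns fast.
  Counterexample : Subset 13 → Set
  Counterexample p =
    T (at p 6) × + 11 / 4 <ℚ harmonic (counts (at p)) × AllPairs (Separated (at p)) (nbhd 6) × sort (counts (at p)) ≢ target

  counterexample? : ∀ p → Dec (Counterexample p)
  counterexample? p =
    T? (at p 6) ×-dec + 11 / 4 <ℚ? harmonic (counts (at p)) ×-dec AllPairs.allPairs? (separated? (at p)) (nbhd 6)
    ×-dec ¬? (≡-dec ℕ._≟_ (sort (counts (at p))) target)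

  heavy-pattern : ∀ p → T (at p 6) → + 11 / 4 <ℚ harmonic (counts (at p)) → AllPairs (Separated (at p)) (nbhd 6) →
                  sort (counts (at p)) ≡ target
  heavy-pattern p centre heavy separated = decidable-stable (≡-dec ℕ._≟_ _ target)
    (λ ≢target → from-no (anySubset? counterexample?) (p , centre , heavy , separated , ≢target))

module Window where

  open import Data.Bool using (Bool; T)
  open import Data.Bool.Properties using (T-≡)
  open import Data.Nat using (ℕ; _+_; _≤_; _<_; s≤s; z≤n)
  import Data.Nat.Properties as ℕ
  open import Data.Fin using (Fin; toℕ)
  open import Data.Fin.Subset as Subset using (Subset; ∣_∣)
  open import Data.Fin.Subset.Properties using (∩⇔×; ⊆-antisym)
  open import Data.Product using (_,_; proj₂)
  open import Data.Vec using (lookup; tabulate)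
  open import Data.Vec.Properties using (lookup⇒[]=; []=⇒lookup)
  open import Data.List using (_∷_; map; length)
  open import Data.List.Properties using (length-map; map-∘; map-cong-local; foldr-map)
  open import Data.List.Membership.Propositional using (_∈_)
  open import Data.List.Membership.Propositional.Properties using (∈-filter⁺; ∈-filter⁻; ∈-map⁺; ∈-map⁻)
  open import Data.List.Membership.Propositional.Properties.WithK using (unique∧set⇒bag)
  import Data.List.Relation.Binary.Subset.Propositional as List
  import Data.List.Relation.Binary.Subset.Propositional.Properties as List
  open import Data.List.Relation.Binary.BagAndSetEquality using (∼bag⇒↭)
  open import Data.List.Relation.Binary.Permutation.Propositional using (_↭_; ↭-trans; ↭-sym; ↭-reflexive)
  open import Data.List.Relation.Binary.Permutation.Propositional.Properties using (map⁺)
  import Data.List.Relation.Unary.All as All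
  import Data.List.Relation.Unary.All.Properties as All
  open import Data.List.Relation.Unary.Unique.Propositional using (Unique)
  import Data.List.Relation.Unary.Unique.Propositional.Properties as Unique
  open import Data.List.Relation.Unary.Sorted.TotalOrder ℕ.≤-totalOrder using (sorted?)
  open import Data.List.Sort.InsertionSort.Base ℕ.≤-decTotalOrder using (sort)
  open import Data.List.Sort.InsertionSort.Properties ℕ.≤-decTotalOrder using (sort-↭)
  open import Data.Integer using (+_)
  open import Data.Rational using (_/_) renaming (_<_ to _<ℚ_)
  open import Function using (_∘_; _⇔_; mk⇔; Equivalence)
  open import Function.Construct.Composition using (_⇔-∘_)
  import Function.Properties.Equivalence as ⇔
  open import Relation.Nullary.Decidable using (T?; from-yes)
  open import Relation.Binary.PropositionalEquality
  open ≡-Reasoning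
  open import Defs
  open Cyclic
  open Neighbourhood
  open ListFacts
  open LocalModel

  module _ (m : ℕ) (u : Fin (13 + m)) where

    origin : Fin (13 + m)
    origin = shift u (7 + m)

    -- position c of the window is the vertex u + c − 6
    window : ℕ → Fin (13 + m)
    window = shift origin

    window-centre : window 6 ≡ u
    window-centre = begin
      shift (shift u (7 + m)) 6   ≡⟨ shift-shift u (7 + m) 6 ⟩
      shift u (7 + m + 6)         ≡⟨ cong (shift u) (ℕ.+-comm (7 + m) 6) ⟩
      shift u (0 + (13 + m))      ≡⟨ shift-+n u 0 ⟩
      shift u 0                   ≡⟨ shift-0 u ⟩
      u                           ∎

    window-injective : ∀ {c c'} → c < 13 → c' < 13 → window c ≡ window c' → c ≡ c'
    window-injective c<13 c'<13 =
      shift-injective origin (ℕ.<-≤-trans c<13 (ℕ.m≤m+n 13 m)) (ℕ.<-≤-trans c'<13 (ℕ.m≤m+n 13 m))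

    map-shift-window : ∀ b → map (shift (window (3 + b))) offsets ≡ map window (nbhd (3 + b))
    map-shift-window b =
      cong₂ _∷_ (shift-0 (window (3 + b))) (
      cong₂ _∷_ (shift-shift origin (3 + b) 1) (
      cong₂ _∷_ (shift-shift origin (3 + b) 3) (
      cong₂ _∷_ (shift-back (s≤s z≤n) origin (2 + b)) (
      cong₂ _∷_ (shift-back (s≤s (s≤s (s≤s z≤n))) origin b) refl))))

    ∈-Nlist-window : ∀ {a} → 3 ≤ a → ∀ j → j ∈ Nlist (window a) ⇔ j ∈ map window (nbhd a)
    ∈-Nlist-window (s≤s (s≤s (s≤s {n = b} z≤n))) j =
      subst (λ xs → j ∈ Nlist (window (3 + b)) ⇔ j ∈ xs) (map-shift-window b)
        (∈-Nlist⇔∈-map-shift (s≤s (s≤s (s≤s (s≤s z≤n)))) (window (3 + b)) j)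

    ∈-N-window : ∀ {a} → 3 ≤ a → ∀ j → j Subset.∈ N[ window a ] ⇔ j ∈ map window (nbhd a)
    ∈-N-window 3≤a j = ∈-Nlist-window 3≤a j ⇔-∘ ∈-N⇔∈-Nlist (window _) j

    Nlist-window↭ : ∀ {a} → Inner a → Nlist (window a) ↭ map window (nbhd a)
    Nlist-window↭ {a} (3≤a , nbhd<13 , nbhd!) = ∼bag⇒↭ (unique∧set⇒bag
      (Nlist-unique (window a)) (map⁺-Unique-on window-injective nbhd<13 nbhd!) (∈-Nlist-window 3≤a _))

    module _ (S : Subset (13 + m)) where

      localCode : Subset 13
      localCode = tabulate (λ i → lookup S (window (toℕ i)))

      χ : ℕ → Bool
      χ = at localCode

      T-χ⇔ : ∀ {c} → c < 13 → T (χ c) ⇔ window c Subset.∈ S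
      T-χ⇔ {c} c<13 = mk⇔
        (λ t → lookup⇒[]= (window c) S (trans (sym (at-tabulate (lookup S ∘ window) c<13)) (Equivalence.to T-≡ t)))
        (λ w∈S → Equivalence.from T-≡ (trans (at-tabulate (lookup S ∘ window) c<13) ([]=⇒lookup w∈S)))

      ∈-S[window]⇔ : ∀ {a} → Inner a → ∀ j → j Subset.∈ S[ S ] (window a) ⇔ j ∈ map window (trace χ a)
      ∈-S[window]⇔ {a} (3≤a , nbhd<13 , _) j = mk⇔ to from
        where
        to : j Subset.∈ S[ S ] (window a) → j ∈ map window (trace χ a)
        to j∈ with Equivalence.to ∩⇔× j∈
        ... | j∈N , j∈S with ∈-map⁻ window (Equivalence.to (∈-N-window 3≤a j) j∈N)
        ... | c , c∈ , refl =
          ∈-map⁺ window (∈-filter⁺ (T? ∘ χ) c∈ (Equivalence.from (T-χ⇔ (All.lookup nbhd<13 c∈)) j∈S))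
        from : j ∈ map window (trace χ a) → j Subset.∈ S[ S ] (window a)
        from j∈ with ∈-map⁻ window j∈
        ... | c , c∈ , refl with ∈-filter⁻ (T? ∘ χ) {xs = nbhd a} c∈
        ... | c∈nbhd , χc = Equivalence.from ∩⇔×
          (Equivalence.from (∈-N-window 3≤a j) (∈-map⁺ window c∈nbhd) , Equivalence.to (T-χ⇔ (All.lookup nbhd<13 c∈nbhd)) χc)

      ∣S[window]∣≡weight : ∀ {a} → Inner a → ∣ S[ S ] (window a) ∣ ≡ weight χ a
      ∣S[window]∣≡weight {a} inner@(_ , nbhd<13 , nbhd!) = begin
        ∣ S[ S ] (window a) ∣             ≡⟨ length≡∣∣ trace! (⇔.sym (∈-S[window]⇔ inner _)) ⟨
        length (map window (trace χ a))   ≡⟨ length-map window (trace χ a) ⟩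
        weight χ a                        ∎
        where
        trace! : Unique (map window (trace χ a))
        trace! = map⁺-Unique-on window-injective (All.filter⁺ (T? ∘ χ) nbhd<13) (Unique.filter⁺ (T? ∘ χ) nbhd!)

      S[window]-cong : ∀ {a a'} → Inner a → Inner a' → trace χ a List.⊆ trace χ a' → trace χ a' List.⊆ trace χ a →
                       S[ S ] (window a) ≡ S[ S ] (window a')
      S[window]-cong inner inner' tr⊆tr' tr'⊆tr = ⊆-antisym
        (Equivalence.from (∈-S[window]⇔ inner' _) ∘ List.map⁺ window tr⊆tr' ∘ Equivalence.to (∈-S[window]⇔ inner _))
        (Equivalence.from (∈-S[window]⇔ inner _) ∘ List.map⁺ window tr'⊆tr ∘ Equivalence.to (∈-S[window]⇔ inner' _))

      card : Fin (13 + m) → ℕ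
      card x = ∣ S[ S ] x ∣

      counts-↭ : map card (Nlist u) ↭ counts χ
      counts-↭ = subst (λ v → map card (Nlist v) ↭ counts χ) window-centre (↭-trans
        (map⁺ card (Nlist-window↭ (All.head nbhd-6-inner)))
        (↭-reflexive (trans (sym (map-∘ {g = card} {f = window} (nbhd 6))) (map-cong-local (All.map ∣S[window]∣≡weight nbhd-6-inner)))))

      share≡harmonic : share S u ≡ harmonic (counts χ)
      share≡harmonic = trans (sym (foldr-map _ card _ (Nlist u))) (harmonic-↭ counts-↭)

      separated : IdentifyingCode S → ∀ {a a'} → Inner a → Inner a' → a ≢ a' → Separated χ a a'
      separated (_ , distinct) inner inner' a≢a' (tr⊆tr' , tr'⊆tr) =
        distinct _ _ (a≢a' ∘ window-injective (Inner⇒<13 inner) (Inner⇒<13 inner')) (S[window]-cong inner inner' tr⊆tr' tr'⊆tr)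

      centre : u Subset.∈ S → T (χ 6)
      centre u∈S = Equivalence.from (T-χ⇔ (Inner⇒<13 (All.head nbhd-6-inner))) (subst (Subset._∈ S) (sym window-centre) u∈S)

      profile-heavy : IdentifyingCode S → u Subset.∈ S → + 11 / 4 <ℚ share S u → profile S u ≡ target
      profile-heavy code u∈S heavy = sort-unique (from-yes (sorted? ℕ._≤?_ target)) counts↭target
        where
        sorted-counts : sort (counts χ) ≡ target
        sorted-counts = heavy-pattern localCode (centre u∈S) (subst (+ 11 / 4 <ℚ_) share≡harmonic heavy)
          (AllPairs-map-on (separated code) nbhd-6-inner (proj₂ (proj₂ (All.head nbhd-6-inner))))
        counts↭target : map card (Nlist u) ↭ target
        counts↭target = ↭-trans counts-↭ (↭-trans (↭-sym (sort-↭ (counts χ))) (↭-reflexive sorted-counts))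

open import Defs
open import Data.Nat using (ℕ; _≤_; NonZero; s≤s; z≤n)
open import Data.Fin using (Fin)
open import Data.Fin.Subset using (Subset; _∈_)
open import Data.List using (List; []; _∷_)
open import Data.Integer using (+_)
open import Data.Rational using (_<_; _/_)
open import Relation.Binary.PropositionalEquality using (_≡_)

lemma3 : (n : ℕ) → .{{_ : NonZero n}} → 13 ≤ n → (S : Subset n) → IdentifyingCode S →
         (u : Fin n) → u ∈ S → (+ 11 / 4) < share S u →
         profile S u ≡ 1 ∷ 2 ∷ 2 ∷ 2 ∷ 3 ∷ []
lemma3 _ (s≤s (s≤s (s≤s (s≤s (s≤s (s≤s (s≤s (s≤s (s≤s (s≤s (s≤s (s≤s (s≤s (z≤n {m})))))))))))))) S code u u∈S heavy =
  Window.profile-heavy m u S code u∈S heavy
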